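{- Let $N\ge1$ be an integer. Let $\mathrm{GL}_3^+(\mathbb{Q})$ act on lattices in $\mathbb{R}^3$ (column vectors) from the left, let $L_1=\mathbb{Z}e_1+\mathbb{Z}e_2+\mathbb{Z}e_3$ and, for $M\in\mathbb{N}$, $L_M=\mathbb{Z}e_1+\mathbb{Z}e_2+\mathbb{Z}Me_3=\mathrm{diag}(1,1,M)L_1$. Then the set of lattices in the orbit $\mathrm{GL}_3^+(\mathbb{Q})\cdot L_1$ that are fixed by every element of $\Gamma_0(N)\le\mathrm{SL}_3(\mathbb{Z})$ is $$\bigcup_{M\mid N}\{qL_M:q\in\mathbb{Q}_{>0}\}.$$
   Context: $\Gamma_0(N)\le\mathrm{SL}_3(\mathbb{Z})$ is the subgroup of integral matrices whose last row is congruent modulo $N$ to $(0,0,\ast)$. $\mathrm{GL}_3^+(\mathbb{Q})$ is the group of invertible rational $3\times3$ matrices of positive determinant; $e_1,e_2,e_3$ is the standard basis of $\mathbb{R}^3$. -}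

module Defs where

open import Data.Nat using (ℕ)
open import Data.Integer as ℤ using (ℤ; +_)
open import Data.Integer.Divisibility as ℤD using ()
open import Data.Rational as ℚ using (ℚ; 0ℚ; _/_)
open import Data.Fin using (Fin; zero; suc)
open import Data.Product using (Σ; ∃; _×_; _,_)
open import Relation.Binary.PropositionalEquality using (_≡_)

-- column vectors in ℚ^3 and 3×3 matrices (row index first)
Vec3 : Set → Set
Vec3 A = Fin 3 → A

Mat3 : Set → Set
Mat3 A = Fin 3 → Fin 3 → A

i0 i1 i2 : Fin 3
i0 = zero
i1 = suc zero
i2 = suc (suc zero)

ι : ℤ → ℚ
ι z = z / 1

ιV : Vec3 ℤ → Vec3 ℚ
ιV v i = ι (v i)

ιM : Mat3 ℤ → Mat3 ℚ
ιM A i j = ι (A i j)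

_·_ : Mat3 ℚ → Vec3 ℚ → Vec3 ℚ
(A · v) i = A i i0 ℚ.* v i0 ℚ.+ A i i1 ℚ.* v i1 ℚ.+ A i i2 ℚ.* v i2

_⊙_ : ℚ → Vec3 ℚ → Vec3 ℚ
(q ⊙ v) i = q ℚ.* v i

detℤ : Mat3 ℤ → ℤ
detℤ A =
  A i0 i0 ℤ.* (A i1 i1 ℤ.* A i2 i2 ℤ.- A i1 i2 ℤ.* A i2 i1)
  ℤ.- A i0 i1 ℤ.* (A i1 i0 ℤ.* A i2 i2 ℤ.- A i1 i2 ℤ.* A i2 i0)
  ℤ.+ A i0 i2 ℤ.* (A i1 i0 ℤ.* A i2 i1 ℤ.- A i1 i1 ℤ.* A i2 i0)

detℚ : Mat3 ℚ → ℚ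
detℚ A =
  A i0 i0 ℚ.* (A i1 i1 ℚ.* A i2 i2 ℚ.- A i1 i2 ℚ.* A i2 i1)
  ℚ.- A i0 i1 ℚ.* (A i1 i0 ℚ.* A i2 i2 ℚ.- A i1 i2 ℚ.* A i2 i0)
  ℚ.+ A i0 i2 ℚ.* (A i1 i0 ℚ.* A i2 i1 ℚ.- A i1 i1 ℚ.* A i2 i0)

GL3+ : Mat3 ℚ → Set
GL3+ g = 0ℚ ℚ.< detℚ g

Γ₀ : ℕ → Mat3 ℤ → Set
Γ₀ N γ = (detℤ γ ≡ + 1) × ((+ N) ℤD.∣ γ i2 i0) × ((+ N) ℤD.∣ γ i2 i1)

-- lattices in ℚ^3 ⊂ ℝ^3 are represented by subsets (predicates on ℚ^3);
-- all lattices in GL₃⁺(ℚ)·L₁ lie in ℚ^3.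
Subset3 : Set₁
Subset3 = Vec3 ℚ → Set

latticeOf : Mat3 ℚ → Subset3
latticeOf g x = ∃ λ (v : Vec3 ℤ) → ∀ i → x i ≡ (g · ιV v) i

image : Mat3 ℚ → Subset3 → Subset3
image A L x = ∃ λ y → L y × (∀ i → x i ≡ (A · y) i)

scale : ℚ → Subset3 → Subset3
scale q L x = ∃ λ y → L y × (∀ i → x i ≡ (q ⊙ y) i)

_≐_ : Subset3 → Subset3 → Set
L ≐ L' = (∀ x → L x → L' x) × (∀ x → L' x → L x)

L_ : ℕ → Subset3
L_ M x = ∃ λ (v : Vec3 ℤ) →
  (x i0 ≡ ι (v i0)) × (x i1 ≡ ι (v i1)) × (x i2 ≡ ι (+ M ℤ.* v i2))

module Submission where

-- Γ₀(N) contains the transvections 1 + E₀₁, 1 + E₀₂, 1 + E₁₀ and 1 + N E₂₀. If Λ = g ℤ³ is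
-- Γ₀(N)-stable then (τ − 1) Λ ⊆ Λ for each of them, so the groups A_k = {t : t e_k ∈ Λ} satisfy
-- A₀ = A₁ ⊇ A₂ ⊇ N A₀, every coordinate of Λ lies in A₀ and every last coordinate in A₂. The
-- entries of g lie in A₀ and generate a subgroup ℤa with a > 0 (det g ≠ 0); its last row lies in
-- A₂ and generates ℤb. Then b ∈ ℤa and N a ∈ ℤb, so b = ±M a with M ∣ N, and Λ = a L_M.
-- Conversely, if M ∣ N then γ ∈ Γ₀(N) and its inverse adj γ have last row ≡ (0, 0, ∗) mod M,
-- hence both preserve q L_M.

open import Defs
open import Data.Nat using (ℕ; _≥_)
open import Data.Nat.Divisibility using (_∣_)
open import Data.Rational using (ℚ; 0ℚ; _<_)
open import Data.Product using (Σ; ∃; _×_)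
open import Function.Bundles using (_⇔_; mk⇔)

open import Data.Nat as ℕ using (zero; suc)
import Data.Nat.Properties as ℕP
open import Data.Nat.Divisibility as ℕ∣ using (_∣0)
open import Data.Nat.Coprimality using (1-coprimeTo) renaming (sym to coprime-sym)
open import Data.Integer as ℤ using (ℤ; +_; -[1+_]; +[1+_])
import Data.Integer.Properties as ℤP
open import Data.Integer.DivMod using (a≡a%n+[a/n]*n; n%d<d)
import Data.Integer.DivMod as ℤDM
open import Data.Integer.Divisibility.Signed
  using (divides; ∣-refl; ∣-trans; ∣ᵤ⇒∣; ∣m∣n⇒∣m+n; ∣m∣n⇒∣m-n; ∣n⇒∣m*n; ∣m⇒∣m*n)
  renaming (_∣_ to _∣ᶻ_)
import Data.Integer.Tactic.RingSolver as ℤSolver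
open import Data.Rational as ℚ using (1ℚ; mkℚ; ↥_; ↧_)
import Data.Rational.Properties as ℚP
import Data.Rational.Unnormalised as ℚᵘ
open import Data.Product using (∃-syntax; _,_; proj₁; proj₂)
open import Data.Sum using ([_,_]′)
open import Data.Fin as F using (Fin; zero; suc)
open import Data.Bool using (true; false; if_then_else_; _∧_)
open import Function using (case_of_; _∘_)
open import Relation.Nullary using (does; contradiction)
open import Relation.Nullary.Decidable.Core using (dec⇒maybe)
open import Relation.Binary.Definitions using (tri<; tri≈; tri>)
open import Relation.Binary.PropositionalEquality
import Tactic.RingSolver.Core.AlmostCommutativeRing as ACR
open import Tactic.RingSolver using (solve-∀)

-- The zero test lets the solver normalise numeric constants such as 0ℚ and 1ℚ.
ℚ-ring : ACR.AlmostCommutativeRing _ _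
ℚ-ring = ACR.fromCommutativeRing ℚP.+-*-commutativeRing (λ x → dec⇒maybe (0ℚ ℚP.≟ x))

ι-mkℚ : ∀ z → ι z ≡ mkℚ z 0 (coprime-sym (1-coprimeTo ℤ.∣ z ∣))
ι-mkℚ z = ℚP.↥p/↧p≡p (mkℚ z 0 (coprime-sym (1-coprimeTo ℤ.∣ z ∣)))

ι-+ : ∀ a b → ι (a ℤ.+ b) ≡ ι a ℚ.+ ι b
ι-+ a b rewrite ι-mkℚ a | ι-mkℚ b =
  trans (ι-mkℚ (a ℤ.+ b))
    (sym (trans (cong ι (cong₂ ℤ._+_ (ℤP.*-identityʳ a) (ℤP.*-identityʳ b))) (ι-mkℚ (a ℤ.+ b))))

ι-* : ∀ a b → ι (a ℤ.* b) ≡ ι a ℚ.* ι b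
ι-* a b rewrite ι-mkℚ a | ι-mkℚ b = refl

ι-neg : ∀ a → ι (ℤ.- a) ≡ ℚ.- ι a
ι-neg a = trans (ι-mkℚ (ℤ.- a)) (trans (neg-mkℚ a) (cong ℚ.-_ (sym (ι-mkℚ a))))
  where
  neg-mkℚ : ∀ a → mkℚ (ℤ.- a) 0 (coprime-sym (1-coprimeTo ℤ.∣ ℤ.- a ∣))
                ≡ ℚ.- mkℚ a 0 (coprime-sym (1-coprimeTo ℤ.∣ a ∣))
  neg-mkℚ (+ zero) = refl
  neg-mkℚ +[1+ n ] = refl
  neg-mkℚ -[1+ n ] = refl

ι-injective : ∀ {a b} → ι a ≡ ι b → a ≡ b
ι-injective {a} {b} e = trans (cong ↥_ (sym (ι-mkℚ a))) (trans (cong ↥_ e) (cong ↥_ (ι-mkℚ b)))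

p*ι↧p≡ι↥p : ∀ p → p ℚ.* ι (↧ p) ≡ ι (↥ p)
p*ι↧p≡ι↥p (mkℚ n d _) rewrite ι-mkℚ (+ suc d) =
  ℚP.fromℚᵘ-cong {ℚᵘ.mkℚᵘ (n ℤ.* + suc d) (d ℕ.* 1)} {ℚᵘ.mkℚᵘ n 0} (ℚᵘ.*≡* eq)
  where
  eq : (n ℤ.* + suc d) ℤ.* + 1 ≡ n ℤ.* + suc (d ℕ.* 1)
  eq rewrite ℕP.*-identityʳ d = ℤP.*-identityʳ _

record Bézout (p q : ℤ) : Set where
  constructor bézout
  field
    gcd x y : ℤ
    identity : gcd ≡ x ℤ.* p ℤ.+ y ℤ.* q
    gcd∣p : gcd ∣ᶻ p
    gcd∣q : gcd ∣ᶻ q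

Bézout-zero : ∀ p → Bézout p (+ 0)
Bézout-zero p =
  bézout p (+ 1) (+ 0) (sym (trans (ℤP.+-identityʳ _) (ℤP.*-identityˡ p))) ∣-refl (divides (+ 0) refl)

Bézout-step : ∀ {p q} r d → p ≡ r ℤ.+ d ℤ.* q → Bézout q r → Bézout p q
Bézout-step {p} {q} r d refl (bézout t x y t≡ t∣q t∣r) =
  bézout t y (x ℤ.- y ℤ.* d) (trans t≡ (shift x y q r d)) (∣m∣n⇒∣m+n t∣r (∣n⇒∣m*n d t∣q)) t∣q
  where
  shift : ∀ x y q r d → x ℤ.* q ℤ.+ y ℤ.* r ≡ y ℤ.* (r ℤ.+ d ℤ.* q) ℤ.+ (x ℤ.- y ℤ.* d) ℤ.* q
  shift = ℤSolver.solve-∀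

Bézout-division : ∀ p q .{{_ : ℤ.NonZero q}} → Bézout q (+ (p ℤDM.% q)) → Bézout p q
Bézout-division p q = Bézout-step (+ (p ℤDM.% q)) (p ℤDM./ q) (a≡a%n+[a/n]*n p q)

Bézout-< : ∀ f p q → ℤ.∣ q ∣ ℕ.< f → Bézout p q
Bézout-< (suc f) p (+ zero)    _   = Bézout-zero p
Bézout-< (suc f) p q@(+[1+ _ ]) q<f =
  Bézout-division p q (Bézout-< f q _ (ℕP.<-≤-trans (n%d<d p q) (ℕP.≤-pred q<f)))
Bézout-< (suc f) p q@(-[1+ _ ]) q<f =
  Bézout-division p q (Bézout-< f q _ (ℕP.<-≤-trans (n%d<d p q) (ℕP.≤-pred q<f)))

Bézout-exists : ∀ p q → Bézout p q
Bézout-exists p q = Bézout-< (suc ℤ.∣ q ∣) p q (ℕP.n<1+n _)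

-- Subgroups of ℚ

infix 4 _∣ℤ_

_∣ℤ_ : ℚ → ℚ → Set
t ∣ℤ r = ∃[ k ] r ≡ ι k ℚ.* t

∣ℤ-trans : ∀ {t r s} → t ∣ℤ r → r ∣ℤ s → t ∣ℤ s
∣ℤ-trans {t} (k , refl) (l , refl) =
  l ℤ.* k , trans (sym (ℚP.*-assoc (ι l) (ι k) t)) (cong (ℚ._* t) (sym (ι-* l k)))

∣ℤ-neg : ∀ {t r} → t ∣ℤ r → ℚ.- t ∣ℤ r
∣ℤ-neg {t} (k , refl) = ℤ.- k , trans (neg-swap (ι k) t) (cong (ℚ._* ℚ.- t) (sym (ι-neg k)))
  where
  neg-swap : ∀ a b → a ℚ.* b ≡ ℚ.- a ℚ.* ℚ.- b
  neg-swap = solve-∀ ℚ-ring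

ι-*-assoc : ∀ {t p} k d → p ≡ k ℤ.* d → ι p ℚ.* t ≡ ι k ℚ.* (ι d ℚ.* t)
ι-*-assoc {t} k d refl = trans (cong (ℚ._* t) (ι-* k d)) (ℚP.*-assoc (ι k) (ι d) t)

*≡⇒≡*1/ : ∀ x y d .{{_ : ℚ.NonZero d}} → x ℚ.* d ≡ y → x ≡ y ℚ.* ℚ.1/ d
*≡⇒≡*1/ x y d refl = sym (begin
  x ℚ.* d ℚ.* ℚ.1/ d     ≡⟨ ℚP.*-assoc x d (ℚ.1/ d) ⟩
  x ℚ.* (d ℚ.* ℚ.1/ d)   ≡⟨ cong (x ℚ.*_) (ℚP.*-inverseʳ d) ⟩
  x ℚ.* 1ℚ               ≡⟨ ℚP.*-identityʳ x ⟩
  x                      ∎)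
  where open ≡-Reasoning

*-cancelʳ : ∀ x y d .{{_ : ℚ.NonZero d}} → x ℚ.* d ≡ y ℚ.* d → x ≡ y
*-cancelʳ x y d xd≡yd = trans (*≡⇒≡*1/ x _ d xd≡yd) (sym (*≡⇒≡*1/ y _ d refl))

ι-cancelʳ : ∀ x y a .{{_ : ℚ.NonZero a}} → ι x ℚ.* a ≡ ι y ℚ.* a → x ≡ y
ι-cancelʳ x y a eq = ι-injective {x} {y} (*-cancelʳ (ι x) (ι y) a eq)

common-denominator : ∀ r s → ∃[ u ] ∃[ p ] ∃[ q ] r ≡ ι p ℚ.* u × s ≡ ι q ℚ.* u
common-denominator r s = ℚ.1/ D , ↥ r ℤ.* ↧ s , ↥ s ℤ.* ↧ r , r≡ , s≡
  where
  D : ℚ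
  D = ι (↧ r ℤ.* ↧ s)
  instance
    D-nonZero : ℚ.NonZero D
    D-nonZero = ℚ.≢-nonZero λ D≡0 → case ι-injective {↧ r ℤ.* ↧ s} {+ 0} D≡0 of λ ()
  clear : ∀ p e → p ℚ.* ι (↧ p ℤ.* e) ≡ ι (↥ p ℤ.* e)
  clear p e = begin
    p ℚ.* ι (↧ p ℤ.* e)        ≡⟨ cong (p ℚ.*_) (ι-* (↧ p) e) ⟩
    p ℚ.* (ι (↧ p) ℚ.* ι e)    ≡⟨ ℚP.*-assoc p (ι (↧ p)) (ι e) ⟨
    p ℚ.* ι (↧ p) ℚ.* ι e      ≡⟨ cong (ℚ._* ι e) (p*ι↧p≡ι↥p p) ⟩
    ι (↥ p) ℚ.* ι e            ≡⟨ ι-* (↥ p) e ⟨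
    ι (↥ p ℤ.* e)              ∎
    where open ≡-Reasoning
  r≡ : r ≡ ι (↥ r ℤ.* ↧ s) ℚ.* ℚ.1/ D
  r≡ = *≡⇒≡*1/ r _ D (clear r (↧ s))
  s≡ : s ≡ ι (↥ s ℤ.* ↧ r) ℚ.* ℚ.1/ D
  s≡ = *≡⇒≡*1/ s _ D (trans (cong (λ e → s ℚ.* ι e) (ℤP.*-comm (↧ r) (↧ s))) (clear s (↧ r)))

-- Existence proofs are kept opaque: unfolding them during unification is prohibitively slow.
opaque
  ℤ-gcd : ∀ r s → ∃[ t ] (∃[ m ] ∃[ n ] t ≡ ι m ℚ.* r ℚ.+ ι n ℚ.* s) × t ∣ℤ r × t ∣ℤ s
  ℤ-gcd r s = gcd-of (common-denominator r s)
    where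
    gcd-of : (∃[ u ] ∃[ p ] ∃[ q ] r ≡ ι p ℚ.* u × s ≡ ι q ℚ.* u) →
             ∃[ t ] (∃[ m ] ∃[ n ] t ≡ ι m ℚ.* r ℚ.+ ι n ℚ.* s) × t ∣ℤ r × t ∣ℤ s
    gcd-of (u , p , q , r≡ , s≡) with Bézout-exists p q
    ... | bézout d x y d≡ (divides k p≡) (divides l q≡) =
      ι d ℚ.* u ,
      (x , y , trans combination (sym (cong₂ (λ a b → ι x ℚ.* a ℚ.+ ι y ℚ.* b) r≡ s≡))) ,
      (k , trans r≡ (ι-*-assoc k d p≡)) , (l , trans s≡ (ι-*-assoc l d q≡))
      where
      combination : ι d ℚ.* u ≡ ι x ℚ.* (ι p ℚ.* u) ℚ.+ ι y ℚ.* (ι q ℚ.* u)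
      combination = begin
        ι d ℚ.* u                                     ≡⟨ cong (λ z → ι z ℚ.* u) d≡ ⟩
        ι (x ℤ.* p ℤ.+ y ℤ.* q) ℚ.* u                 ≡⟨ cong (ℚ._* u) (ι-+ (x ℤ.* p) (y ℤ.* q)) ⟩
        (ι (x ℤ.* p) ℚ.+ ι (y ℤ.* q)) ℚ.* u           ≡⟨ cong (ℚ._* u) (cong₂ ℚ._+_ (ι-* x p) (ι-* y q)) ⟩
        (ι x ℚ.* ι p ℚ.+ ι y ℚ.* ι q) ℚ.* u           ≡⟨ distrib (ι x) (ι p) (ι y) (ι q) u ⟩
        ι x ℚ.* (ι p ℚ.* u) ℚ.+ ι y ℚ.* (ι q ℚ.* u)   ∎
        where
        open ≡-Reasoning
        distrib : ∀ a b c d u → (a ℚ.* b ℚ.+ c ℚ.* d) ℚ.* u ≡ a ℚ.* (b ℚ.* u) ℚ.+ c ℚ.* (d ℚ.* u)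
        distrib = solve-∀ ℚ-ring

record IsSubgroup (P : ℚ → Set) : Set where
  field
    0∈ : P 0ℚ
    +-closed : ∀ {r s} → P r → P s → P (r ℚ.+ s)
    ℤ*-closed : ∀ m {r} → P r → P (ι m ℚ.* r)

module _ {P : ℚ → Set} (P-subgroup : IsSubgroup P) where
  open IsSubgroup P-subgroup

  neg-closed : ∀ {t} → P t → P (ℚ.- t)
  neg-closed {t} Pt = subst P (-1*t≡-t t) (ℤ*-closed -[1+ 0 ] Pt)
    where
    -1*t≡-t : ∀ t → ℚ.- 1ℚ ℚ.* t ≡ ℚ.- t
    -1*t≡-t = solve-∀ ℚ-ring

  opaque
    generator : ∀ {n} (r : Fin n → ℚ) → (∀ i → P (r i)) → ∃[ t ] P t × (∀ i → t ∣ℤ r i)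
    generator {zero} r _ = 0ℚ , 0∈ , λ ()
    generator {suc _} r Pr with generator (r ∘ suc) (Pr ∘ suc)
    ... | t , Pt , t∣r with ℤ-gcd (r zero) t
    ... | u , (x , y , u≡) , u∣r₀ , u∣t =
      u , subst P (sym u≡) (+-closed (ℤ*-closed x (Pr zero)) (ℤ*-closed y Pt)) ,
      λ { zero → u∣r₀ ; (suc i) → ∣ℤ-trans u∣t (t∣r i) }

    matrix-generator : ∀ {m n} (A : Fin m → Fin n → ℚ) → (∀ i j → P (A i j)) →
      ∃[ t ] P t × (∀ i j → t ∣ℤ A i j)
    matrix-generator A PA = combine (generator (proj₁ ∘ row) (proj₁ ∘ proj₂ ∘ row))
      where
      row : ∀ i → ∃[ t ] P t × (∀ j → t ∣ℤ A i j)
      row i = generator (A i) (PA i)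
      combine : (∃[ t ] P t × (∀ i → t ∣ℤ proj₁ (row i))) → ∃[ t ] P t × (∀ i j → t ∣ℤ A i j)
      combine (t , Pt , t∣row) = t , Pt , λ i j → ∣ℤ-trans (t∣row i) (proj₂ (proj₂ (row i)) j)

    positive-generator : ∀ {t} → P t → t ≢ 0ℚ → ∃[ t′ ] 0ℚ < t′ × P t′ × (∀ {r} → t ∣ℤ r → t′ ∣ℤ r)
    positive-generator {t} Pt t≢0 with ℚP.<-cmp t 0ℚ
    ... | tri< t<0 _ _ = ℚ.- t , ℚP.neg-antimono-< t<0 , neg-closed Pt , ∣ℤ-neg
    ... | tri≈ _ t≡0 _ = contradiction t≡0 t≢0
    ... | tri> _ _ t>0 = t , t>0 , Pt , λ t∣r → t∣r

    abs-multiple : ∀ {t a} m → P t → t ≡ ι m ℚ.* a →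
      P (ι (+ ℤ.∣ m ∣) ℚ.* a) × (∀ {r} → t ∣ℤ r → ι (+ ℤ.∣ m ∣) ℚ.* a ∣ℤ r)
    abs-multiple {t} {a} m Pt t≡ma = [ same-sign , opposite-sign ]′ (ℤP.+∣i∣≡i⊎+∣i∣≡-i m)
      where
      Generates : ℚ → Set
      Generates b = P b × (∀ {r} → t ∣ℤ r → b ∣ℤ r)
      same-sign : + ℤ.∣ m ∣ ≡ m → Generates (ι (+ ℤ.∣ m ∣) ℚ.* a)
      same-sign ∣m∣≡m = subst Generates (trans t≡ma (cong (λ z → ι z ℚ.* a) (sym ∣m∣≡m))) (Pt , λ t∣r → t∣r)
      opposite-sign : + ℤ.∣ m ∣ ≡ ℤ.- m → Generates (ι (+ ℤ.∣ m ∣) ℚ.* a)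
      opposite-sign ∣m∣≡-m = subst Generates (sym ∣m∣a≡-t) (neg-closed Pt , ∣ℤ-neg)
        where
        ∣m∣a≡-t : ι (+ ℤ.∣ m ∣) ℚ.* a ≡ ℚ.- t
        ∣m∣a≡-t = begin
          ι (+ ℤ.∣ m ∣) ℚ.* a   ≡⟨ cong (λ z → ι z ℚ.* a) ∣m∣≡-m ⟩
          ι (ℤ.- m) ℚ.* a       ≡⟨ cong (ℚ._* a) (ι-neg m) ⟩
          ℚ.- ι m ℚ.* a         ≡⟨ ℚP.neg-distribˡ-* (ι m) a ⟨
          ℚ.- (ι m ℚ.* a)       ≡⟨ cong ℚ.-_ t≡ma ⟨
          ℚ.- t                 ∎
          where open ≡-Reasoning

-- Linear algebra over ℤ and ℚ

infixl 6 _⊕_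
infixr 7 _·ℤ_

_⊕_ : Vec3 ℚ → Vec3 ℚ → Vec3 ℚ
(u ⊕ w) i = u i ℚ.+ w i

_·ℤ_ : Mat3 ℤ → Vec3 ℤ → Vec3 ℤ
(A ·ℤ Z) i = A i i0 ℤ.* Z i0 ℤ.+ A i i1 ℤ.* Z i1 ℤ.+ A i i2 ℤ.* Z i2

vec3 : ∀ {A : Set} → A → A → A → Vec3 A
vec3 a b c zero             = a
vec3 a b c (suc zero)       = b
vec3 a b c (suc (suc zero)) = c

·-cong : ∀ A {u w} → u ≗ w → A · u ≗ A · w
·-cong A u≗w i rewrite u≗w i0 | u≗w i1 | u≗w i2 = refl

·-⊕ : ∀ A u w → A · (u ⊕ w) ≗ A · u ⊕ A · w
·-⊕ A u w i = distrib (A i i0) (A i i1) (A i i2) (u i0) (u i1) (u i2) (w i0) (w i1) (w i2)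
  where
  distrib : ∀ a b c u₀ u₁ u₂ w₀ w₁ w₂ →
    a ℚ.* (u₀ ℚ.+ w₀) ℚ.+ b ℚ.* (u₁ ℚ.+ w₁) ℚ.+ c ℚ.* (u₂ ℚ.+ w₂)
      ≡ a ℚ.* u₀ ℚ.+ b ℚ.* u₁ ℚ.+ c ℚ.* u₂ ℚ.+ (a ℚ.* w₀ ℚ.+ b ℚ.* w₁ ℚ.+ c ℚ.* w₂)
  distrib = solve-∀ ℚ-ring

·-⊙ : ∀ A q u → A · (q ⊙ u) ≗ q ⊙ (A · u)
·-⊙ A q u i = commute (A i i0) (A i i1) (A i i2) (u i0) (u i1) (u i2) q
  where
  commute : ∀ a b c u₀ u₁ u₂ q →
    a ℚ.* (q ℚ.* u₀) ℚ.+ b ℚ.* (q ℚ.* u₁) ℚ.+ c ℚ.* (q ℚ.* u₂) ≡ q ℚ.* (a ℚ.* u₀ ℚ.+ b ℚ.* u₁ ℚ.+ c ℚ.* u₂)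
  commute = solve-∀ ℚ-ring

ι-dot : ∀ a b c x y z → ι (a ℤ.* x ℤ.+ b ℤ.* y ℤ.+ c ℤ.* z) ≡ ι a ℚ.* ι x ℚ.+ ι b ℚ.* ι y ℚ.+ ι c ℚ.* ι z
ι-dot a b c x y z rewrite ι-+ (a ℤ.* x ℤ.+ b ℤ.* y) (c ℤ.* z) | ι-+ (a ℤ.* x) (b ℤ.* y)
                        | ι-* a x | ι-* b y | ι-* c z = refl

ιM-·-ιV : ∀ A Z → ιM A · ιV Z ≗ ιV (A ·ℤ Z)
ιM-·-ιV A Z i = sym (ι-dot (A i i0) (A i i1) (A i i2) (Z i0) (Z i1) (Z i2))

ιM-·-⊙ιV : ∀ A q Z → ιM A · (q ⊙ ιV Z) ≗ q ⊙ ιV (A ·ℤ Z)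
ιM-·-⊙ιV A q Z i = trans (·-⊙ (ιM A) q (ιV Z) i) (cong (q ℚ.*_) (ιM-·-ιV A Z i))

detℚ-zero : ∀ A → (∀ i j → A i j ≡ 0ℚ) → detℚ A ≡ 0ℚ
detℚ-zero A A≡0 rewrite A≡0 i0 i0 | A≡0 i0 i1 | A≡0 i0 i2 | A≡0 i1 i0 | A≡0 i1 i1
                      | A≡0 i1 i2 | A≡0 i2 i0 | A≡0 i2 i1 | A≡0 i2 i2 = refl

det>0⇒divisor≢0 : ∀ {t} A → 0ℚ < detℚ A → (∀ i j → t ∣ℤ A i j) → t ≢ 0ℚ
det>0⇒divisor≢0 A det>0 t∣A refl = ℚP.<-irrefl (sym (detℚ-zero A A≡0)) det>0
  where
  A≡0 : ∀ i j → A i j ≡ 0ℚ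
  A≡0 i j = let k , A≡ = t∣A i j in trans A≡ (ℚP.*-zeroʳ (ι k))

∣ℤ-· : ∀ {t} A k v → (∀ j → t ∣ℤ A k j) → t ∣ℤ (A · ιV v) k
∣ℤ-· {t} A k v t∣A with t∣A i0 | t∣A i1 | t∣A i2
... | c₀ , A₀≡ | c₁ , A₁≡ | c₂ , A₂≡ rewrite A₀≡ | A₁≡ | A₂≡ =
  c₀ ℤ.* v i0 ℤ.+ c₁ ℤ.* v i1 ℤ.+ c₂ ℤ.* v i2 ,
  trans (factor (ι c₀) (ι c₁) (ι c₂) (ι (v i0)) (ι (v i1)) (ι (v i2)) t)
        (cong (ℚ._* t) (sym (ι-dot c₀ c₁ c₂ (v i0) (v i1) (v i2))))
  where
  factor : ∀ c₀ c₁ c₂ x y z t →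
    c₀ ℚ.* t ℚ.* x ℚ.+ c₁ ℚ.* t ℚ.* y ℚ.+ c₂ ℚ.* t ℚ.* z ≡ (c₀ ℚ.* x ℚ.+ c₁ ℚ.* y ℚ.+ c₂ ℚ.* z) ℚ.* t
  factor = solve-∀ ℚ-ring

adj : Mat3 ℤ → Mat3 ℤ
adj A zero             zero             = A i1 i1 ℤ.* A i2 i2 ℤ.- A i1 i2 ℤ.* A i2 i1
adj A zero             (suc zero)       = A i0 i2 ℤ.* A i2 i1 ℤ.- A i0 i1 ℤ.* A i2 i2
adj A zero             (suc (suc zero)) = A i0 i1 ℤ.* A i1 i2 ℤ.- A i0 i2 ℤ.* A i1 i1
adj A (suc zero)       zero             = A i1 i2 ℤ.* A i2 i0 ℤ.- A i1 i0 ℤ.* A i2 i2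
adj A (suc zero)       (suc zero)       = A i0 i0 ℤ.* A i2 i2 ℤ.- A i0 i2 ℤ.* A i2 i0
adj A (suc zero)       (suc (suc zero)) = A i0 i2 ℤ.* A i1 i0 ℤ.- A i0 i0 ℤ.* A i1 i2
adj A (suc (suc zero)) zero             = A i1 i0 ℤ.* A i2 i1 ℤ.- A i1 i1 ℤ.* A i2 i0
adj A (suc (suc zero)) (suc zero)       = A i0 i1 ℤ.* A i2 i0 ℤ.- A i0 i0 ℤ.* A i2 i1
adj A (suc (suc zero)) (suc (suc zero)) = A i0 i0 ℤ.* A i1 i1 ℤ.- A i0 i1 ℤ.* A i1 i0

·ℤ-adj : ∀ A Z i → (A ·ℤ adj A ·ℤ Z) i ≡ detℤ A ℤ.* Z i
·ℤ-adj A Z zero =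
  row₀ (A i0 i0) (A i0 i1) (A i0 i2) (A i1 i0) (A i1 i1) (A i1 i2)
       (A i2 i0) (A i2 i1) (A i2 i2) (Z i0) (Z i1) (Z i2)
  where
  row₀ : ∀ a b c d e f g h i x y z →
    a ℤ.* ((e ℤ.* i ℤ.- f ℤ.* h) ℤ.* x ℤ.+ (c ℤ.* h ℤ.- b ℤ.* i) ℤ.* y ℤ.+ (b ℤ.* f ℤ.- c ℤ.* e) ℤ.* z)
    ℤ.+ b ℤ.* ((f ℤ.* g ℤ.- d ℤ.* i) ℤ.* x ℤ.+ (a ℤ.* i ℤ.- c ℤ.* g) ℤ.* y ℤ.+ (c ℤ.* d ℤ.- a ℤ.* f) ℤ.* z)
    ℤ.+ c ℤ.* ((d ℤ.* h ℤ.- e ℤ.* g) ℤ.* x ℤ.+ (b ℤ.* g ℤ.- a ℤ.* h) ℤ.* y ℤ.+ (a ℤ.* e ℤ.- b ℤ.* d) ℤ.* z)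
    ≡ (a ℤ.* (e ℤ.* i ℤ.- f ℤ.* h) ℤ.- b ℤ.* (d ℤ.* i ℤ.- f ℤ.* g) ℤ.+ c ℤ.* (d ℤ.* h ℤ.- e ℤ.* g)) ℤ.* x
  row₀ = ℤSolver.solve-∀
·ℤ-adj A Z (suc zero) =
  row₁ (A i0 i0) (A i0 i1) (A i0 i2) (A i1 i0) (A i1 i1) (A i1 i2)
       (A i2 i0) (A i2 i1) (A i2 i2) (Z i0) (Z i1) (Z i2)
  where
  row₁ : ∀ a b c d e f g h i x y z →
    d ℤ.* ((e ℤ.* i ℤ.- f ℤ.* h) ℤ.* x ℤ.+ (c ℤ.* h ℤ.- b ℤ.* i) ℤ.* y ℤ.+ (b ℤ.* f ℤ.- c ℤ.* e) ℤ.* z)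
    ℤ.+ e ℤ.* ((f ℤ.* g ℤ.- d ℤ.* i) ℤ.* x ℤ.+ (a ℤ.* i ℤ.- c ℤ.* g) ℤ.* y ℤ.+ (c ℤ.* d ℤ.- a ℤ.* f) ℤ.* z)
    ℤ.+ f ℤ.* ((d ℤ.* h ℤ.- e ℤ.* g) ℤ.* x ℤ.+ (b ℤ.* g ℤ.- a ℤ.* h) ℤ.* y ℤ.+ (a ℤ.* e ℤ.- b ℤ.* d) ℤ.* z)
    ≡ (a ℤ.* (e ℤ.* i ℤ.- f ℤ.* h) ℤ.- b ℤ.* (d ℤ.* i ℤ.- f ℤ.* g) ℤ.+ c ℤ.* (d ℤ.* h ℤ.- e ℤ.* g)) ℤ.* y
  row₁ = ℤSolver.solve-∀
·ℤ-adj A Z (suc (suc zero)) =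
  row₂ (A i0 i0) (A i0 i1) (A i0 i2) (A i1 i0) (A i1 i1) (A i1 i2)
       (A i2 i0) (A i2 i1) (A i2 i2) (Z i0) (Z i1) (Z i2)
  where
  row₂ : ∀ a b c d e f g h i x y z →
    g ℤ.* ((e ℤ.* i ℤ.- f ℤ.* h) ℤ.* x ℤ.+ (c ℤ.* h ℤ.- b ℤ.* i) ℤ.* y ℤ.+ (b ℤ.* f ℤ.- c ℤ.* e) ℤ.* z)
    ℤ.+ h ℤ.* ((f ℤ.* g ℤ.- d ℤ.* i) ℤ.* x ℤ.+ (a ℤ.* i ℤ.- c ℤ.* g) ℤ.* y ℤ.+ (c ℤ.* d ℤ.- a ℤ.* f) ℤ.* z)
    ℤ.+ i ℤ.* ((d ℤ.* h ℤ.- e ℤ.* g) ℤ.* x ℤ.+ (b ℤ.* g ℤ.- a ℤ.* h) ℤ.* y ℤ.+ (a ℤ.* e ℤ.- b ℤ.* d) ℤ.* z)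
    ≡ (a ℤ.* (e ℤ.* i ℤ.- f ℤ.* h) ℤ.- b ℤ.* (d ℤ.* i ℤ.- f ℤ.* g) ℤ.+ c ℤ.* (d ℤ.* h ℤ.- e ℤ.* g)) ℤ.* z
  row₂ = ℤSolver.solve-∀

-- Γ₀(N)-invariance of q L_M

record ScaledL (q : ℚ) (M : ℕ) (x : Vec3 ℚ) : Set where
  constructor scaledL
  field
    coords : Vec3 ℤ
    M∣coords₂ : + M ∣ᶻ coords i2
    x≗ : x ≗ q ⊙ ιV coords

scale-L⇒ScaledL : ∀ {x} q M → scale q (L_ M) x → ScaledL q M x
scale-L⇒ScaledL q M (_ , (v , y₀≡ , y₁≡ , y₂≡) , x≡) =
  scaledL (vec3 (v i0) (v i1) (+ M ℤ.* v i2)) (divides (v i2) (ℤP.*-comm (+ M) (v i2)))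
  λ { zero → trans (x≡ i0) (cong (q ℚ.*_) y₀≡)
    ; (suc zero) → trans (x≡ i1) (cong (q ℚ.*_) y₁≡)
    ; (suc (suc zero)) → trans (x≡ i2) (cong (q ℚ.*_) y₂≡) }

ScaledL⇒scale-L : ∀ {q M x} → ScaledL q M x → scale q (L_ M) x
ScaledL⇒scale-L {M = M} (scaledL Z (divides c Z₂≡) x≡) =
  ιV Z , (vec3 (Z i0) (Z i1) c , refl , refl , cong ι (trans Z₂≡ (ℤP.*-comm c (+ M)))) , x≡

ScaledL-resp : ∀ {q M x y} → ScaledL q M y → x ≗ y → ScaledL q M x
ScaledL-resp (scaledL Z M∣Z₂ y≡) x≡y = scaledL Z M∣Z₂ λ i → trans (x≡y i) (y≡ i)

LastRowDivisible : ℕ → Mat3 ℤ → Set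
LastRowDivisible M A = + M ∣ᶻ A i2 i0 × + M ∣ᶻ A i2 i1

Γ₀⇒LastRowDivisible : ∀ {M N} γ → M ∣ N → Γ₀ N γ → LastRowDivisible M γ
Γ₀⇒LastRowDivisible {M} {N} γ M∣N (_ , N∣γ₂₀ , N∣γ₂₁) =
  ∣-trans M∣N′ (∣ᵤ⇒∣ N∣γ₂₀) , ∣-trans M∣N′ (∣ᵤ⇒∣ N∣γ₂₁)
  where
  M∣N′ : + M ∣ᶻ + N
  M∣N′ = ∣ᵤ⇒∣ M∣N

adj-LastRowDivisible : ∀ {M} A → LastRowDivisible M A → LastRowDivisible M (adj A)
adj-LastRowDivisible A (M∣A₂₀ , M∣A₂₁) =
  ∣m∣n⇒∣m-n (∣n⇒∣m*n (A i1 i0) M∣A₂₁) (∣n⇒∣m*n (A i1 i1) M∣A₂₀) ,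
  ∣m∣n⇒∣m-n (∣n⇒∣m*n (A i0 i1) M∣A₂₀) (∣n⇒∣m*n (A i0 i0) M∣A₂₁)

ScaledL-closed : ∀ {q M y} A → LastRowDivisible M A → ScaledL q M y → ScaledL q M (ιM A · y)
ScaledL-closed {q} A (M∣A₂₀ , M∣A₂₁) (scaledL Z M∣Z₂ y≡) =
  scaledL (A ·ℤ Z)
    (∣m∣n⇒∣m+n (∣m∣n⇒∣m+n (∣m⇒∣m*n (Z i0) M∣A₂₀) (∣m⇒∣m*n (Z i1) M∣A₂₁)) (∣n⇒∣m*n (A i2 i2) M∣Z₂))
    λ i → trans (·-cong (ιM A) y≡ i) (ιM-·-⊙ιV A q Z i)

·-adj-cancel : ∀ {x} q A Z → detℤ A ≡ + 1 → x ≗ q ⊙ ιV Z → ιM A · (ιM (adj A) · x) ≗ x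
·-adj-cancel {x} q A Z det≡1 x≡ i = begin
  (ιM A · (ιM (adj A) · x)) i              ≡⟨ ·-cong (ιM A) adj·x≡ i ⟩
  (ιM A · (q ⊙ ιV (adj A ·ℤ Z))) i         ≡⟨ ιM-·-⊙ιV A q (adj A ·ℤ Z) i ⟩
  q ℚ.* ι ((A ·ℤ adj A ·ℤ Z) i)            ≡⟨ cong (λ z → q ℚ.* ι z) (·ℤ-adj A Z i) ⟩
  q ℚ.* ι (detℤ A ℤ.* Z i)                 ≡⟨ cong (λ d → q ℚ.* ι (d ℤ.* Z i)) det≡1 ⟩
  q ℚ.* ι (+ 1 ℤ.* Z i)                    ≡⟨ cong (λ z → q ℚ.* ι z) (ℤP.*-identityˡ (Z i)) ⟩
  q ℚ.* ι (Z i)                            ≡⟨ x≡ i ⟨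
  x i                                      ∎
  where
  open ≡-Reasoning
  adj·x≡ : ιM (adj A) · x ≗ q ⊙ ιV (adj A ·ℤ Z)
  adj·x≡ j = trans (·-cong (ιM (adj A)) x≡ j) (ιM-·-⊙ιV (adj A) q Z j)

≐-sym : ∀ {L L′} → L ≐ L′ → L′ ≐ L
≐-sym (⊆ , ⊇) = ⊇ , ⊆

≐-trans : ∀ {L L′ L″} → L ≐ L′ → L′ ≐ L″ → L ≐ L″
≐-trans (⊆ , ⊇) (⊆′ , ⊇′) = (λ x → ⊆′ x ∘ ⊆ x) , (λ x → ⊇ x ∘ ⊇′ x)

image-cong : ∀ A {L L′} → L ≐ L′ → image A L ≐ image A L′
image-cong A (⊆ , ⊇) =
  (λ { x (y , y∈ , x≡) → y , ⊆ y y∈ , x≡ }) , (λ { x (y , y∈ , x≡) → y , ⊇ y y∈ , x≡ })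

Γ₀-stabilises-scale-L : ∀ {M N} q γ → M ∣ N → Γ₀ N γ → image (ιM γ) (scale q (L_ M)) ≐ scale q (L_ M)
Γ₀-stabilises-scale-L {M} q γ M∣N γ∈Γ₀ = image⊆ , ⊆image
  where
  γ-div : LastRowDivisible M γ
  γ-div = Γ₀⇒LastRowDivisible γ M∣N γ∈Γ₀
  image⊆ : ∀ x → image (ιM γ) (scale q (L_ M)) x → scale q (L_ M) x
  image⊆ x (y , y∈ , x≡) =
    ScaledL⇒scale-L (ScaledL-resp (ScaledL-closed γ γ-div (scale-L⇒ScaledL q M y∈)) x≡)
  ⊆image : ∀ x → scale q (L_ M) x → image (ιM γ) (scale q (L_ M)) x
  ⊆image x x∈ with scale-L⇒ScaledL q M x∈
  ... | x∈′@(scaledL Z _ x≡) =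
    ιM (adj γ) · x ,
    ScaledL⇒scale-L (ScaledL-closed (adj γ) (adj-LastRowDivisible γ γ-div) x∈′) ,
    λ i → sym (·-adj-cancel q γ Z (proj₁ γ∈Γ₀) x≡ i)

scale-L-stable : ∀ {M N Λ} q → M ∣ N → Λ ≐ scale q (L_ M) → ∀ γ → Γ₀ N γ → image (ιM γ) Λ ≐ Λ
scale-L-stable q M∣N Λ≐qL γ γ∈Γ₀ =
  ≐-trans (image-cong (ιM γ) Λ≐qL) (≐-trans (Γ₀-stabilises-scale-L q γ M∣N γ∈Γ₀) (≐-sym Λ≐qL))

-- Transvections and Γ₀(N)-stable lattices

axis : Fin 3 → ℚ → Vec3 ℚ
axis k t l = if does (l F.≟ k) then t else 0ℚ

𝟙 : Mat3 ℤ
𝟙 r s = if does (r F.≟ s) then + 1 else + 0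

unitMat : ℤ → Fin 3 → Fin 3 → Mat3 ℤ
unitMat c i j r s = if does (r F.≟ i) ∧ does (s F.≟ j) then c else + 0

transvection : ℤ → Fin 3 → Fin 3 → Mat3 ℤ
transvection c i j r s = 𝟙 r s ℤ.+ unitMat c i j r s

ιM-+-· : ∀ A B y → ιM (λ r s → A r s ℤ.+ B r s) · y ≗ ιM A · y ⊕ ιM B · y
ιM-+-· A B y k rewrite ι-+ (A k i0) (B k i0) | ι-+ (A k i1) (B k i1) | ι-+ (A k i2) (B k i2) =
  distrib (ι (A k i0)) (ι (A k i1)) (ι (A k i2)) (ι (B k i0)) (ι (B k i1)) (ι (B k i2)) (y i0) (y i1) (y i2)
  where
  distrib : ∀ a₀ a₁ a₂ b₀ b₁ b₂ y₀ y₁ y₂ →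
    (a₀ ℚ.+ b₀) ℚ.* y₀ ℚ.+ (a₁ ℚ.+ b₁) ℚ.* y₁ ℚ.+ (a₂ ℚ.+ b₂) ℚ.* y₂
      ≡ a₀ ℚ.* y₀ ℚ.+ a₁ ℚ.* y₁ ℚ.+ a₂ ℚ.* y₂ ℚ.+ (b₀ ℚ.* y₀ ℚ.+ b₁ ℚ.* y₁ ℚ.+ b₂ ℚ.* y₂)
  distrib = solve-∀ ℚ-ring

·-select : ∀ j c (y : Vec3 ℚ) →
  axis j c i0 ℚ.* y i0 ℚ.+ axis j c i1 ℚ.* y i1 ℚ.+ axis j c i2 ℚ.* y i2 ≡ c ℚ.* y j
·-select zero             c y = select₀ c (y i0) (y i1) (y i2)
  where
  select₀ : ∀ c a b d → c ℚ.* a ℚ.+ 0ℚ ℚ.* b ℚ.+ 0ℚ ℚ.* d ≡ c ℚ.* a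
  select₀ = solve-∀ ℚ-ring
·-select (suc zero)       c y = select₁ c (y i0) (y i1) (y i2)
  where
  select₁ : ∀ c a b d → 0ℚ ℚ.* a ℚ.+ c ℚ.* b ℚ.+ 0ℚ ℚ.* d ≡ c ℚ.* b
  select₁ = solve-∀ ℚ-ring
·-select (suc (suc zero)) c y = select₂ c (y i0) (y i1) (y i2)
  where
  select₂ : ∀ c a b d → 0ℚ ℚ.* a ℚ.+ 0ℚ ℚ.* b ℚ.+ c ℚ.* d ≡ c ℚ.* d
  select₂ = solve-∀ ℚ-ring

·-axis : ∀ A j c → A · axis j c ≗ λ i → c ℚ.* A i j
·-axis A j c i =
  trans (cong₂ ℚ._+_ (cong₂ ℚ._+_ (ℚP.*-comm (A i i0) _) (ℚP.*-comm (A i i1) _)) (ℚP.*-comm (A i i2) _))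
        (·-select j c (A i))

unitVec : Fin 3 → Vec3 ℤ
unitVec j s = if does (s F.≟ j) then + 1 else + 0

ιV-unitVec : ∀ j → ιV (unitVec j) ≗ axis j 1ℚ
ιV-unitVec j s with does (s F.≟ j)
... | true  = refl
... | false = refl

ιM-𝟙 : ∀ y → ιM 𝟙 · y ≗ y
ιM-𝟙 y k = trans (row k) (ℚP.*-identityˡ (y k))
  where
  row : ∀ k → (ιM 𝟙 · y) k ≡ 1ℚ ℚ.* y k
  row zero             = ·-select i0 1ℚ y
  row (suc zero)       = ·-select i1 1ℚ y
  row (suc (suc zero)) = ·-select i2 1ℚ y

ιM-unitMat : ∀ c i j y → ιM (unitMat c i j) · y ≗ axis i (ι c ℚ.* y j)
ιM-unitMat c i j y k with does (k F.≟ i)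
... | false = zero-row (y i0) (y i1) (y i2)
  where
  zero-row : ∀ a b d → 0ℚ ℚ.* a ℚ.+ 0ℚ ℚ.* b ℚ.+ 0ℚ ℚ.* d ≡ 0ℚ
  zero-row = solve-∀ ℚ-ring
... | true with j
... | zero             = ·-select i0 (ι c) y
... | suc zero         = ·-select i1 (ι c) y
... | suc (suc zero)   = ·-select i2 (ι c) y

ιM-transvection : ∀ c i j y → ιM (transvection c i j) · y ≗ y ⊕ axis i (ι c ℚ.* y j)
ιM-transvection c i j y k =
  trans (ιM-+-· 𝟙 (unitMat c i j) y k) (cong₂ ℚ._+_ (ιM-𝟙 y k) (ιM-unitMat c i j y k))


module Stable (N : ℕ) (g : Mat3 ℚ)
  (stable : ∀ γ → Γ₀ N γ → image (ιM γ) (latticeOf g) ≐ latticeOf g) where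

  Λ : Vec3 ℚ → Set
  Λ = latticeOf g

  Λ-resp : ∀ {x y} → Λ y → x ≗ y → Λ x
  Λ-resp (v , y≡) x≡y = v , λ i → trans (x≡y i) (y≡ i)

  Λ-+ : ∀ {u w} → Λ u → Λ w → Λ (u ⊕ w)
  Λ-+ (v , u≡) (v′ , w≡) = (λ j → v j ℤ.+ v′ j) , λ i →
    trans (cong₂ ℚ._+_ (u≡ i) (w≡ i))
          (sym (trans (·-cong g (λ j → ι-+ (v j) (v′ j)) i) (·-⊕ g (ιV v) (ιV v′) i)))

  Λ-ℤ* : ∀ m {u} → Λ u → Λ (ι m ⊙ u)
  Λ-ℤ* m (v , u≡) = (λ j → m ℤ.* v j) , λ i →
    trans (cong (ι m ℚ.*_) (u≡ i))
          (sym (trans (·-cong g (λ j → ι-* m (v j)) i) (·-⊙ g (ι m) (ιV v) i)))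

  Λ-Γ₀ : ∀ γ → Γ₀ N γ → ∀ {y} → Λ y → Λ (ιM γ · y)
  Λ-Γ₀ γ γ∈Γ₀ {y} y∈Λ = proj₁ (stable γ γ∈Γ₀) _ (y , y∈Λ , λ _ → refl)

  Λ-column : ∀ j → Λ (λ i → g i j)
  Λ-column j = unitVec j , λ i →
    sym (trans (·-cong g (ιV-unitVec j) i) (trans (·-axis g j 1ℚ i) (ℚP.*-identityˡ (g i j))))

  Axis : Fin 3 → ℚ → Set
  Axis k t = Λ (axis k t)

  Axis-subgroup : ∀ k → IsSubgroup (Axis k)
  Axis-subgroup k = record
    { 0∈ = Λ-resp (Λ-ℤ* (+ 0) (Λ-column i0)) λ l → trans (axis-0 l) (sym (ℚP.*-zeroˡ (g l i0)))
    ; +-closed = λ r∈ s∈ → Λ-resp (Λ-+ r∈ s∈) (axis-+ _ _)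
    ; ℤ*-closed = λ m r∈ → Λ-resp (Λ-ℤ* m r∈) (axis-ℤ* m _)
    }
    where
    axis-0 : axis k 0ℚ ≗ λ _ → 0ℚ
    axis-0 l with does (l F.≟ k)
    ... | true  = refl
    ... | false = refl
    axis-+ : ∀ r s → axis k (r ℚ.+ s) ≗ axis k r ⊕ axis k s
    axis-+ r s l with does (l F.≟ k)
    ... | true  = refl
    ... | false = refl
    axis-ℤ* : ∀ m r → axis k (ι m ℚ.* r) ≗ ι m ⊙ axis k r
    axis-ℤ* m r l with does (l F.≟ k)
    ... | true  = refl
    ... | false = sym (ℚP.*-zeroʳ (ι m))

  transvection-Axis : ∀ c i j → Γ₀ N (transvection c i j) → ∀ {y} → Λ y → Axis i (ι c ℚ.* y j)
  transvection-Axis c i j τ∈Γ₀ {y} y∈Λ =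
    Λ-resp (Λ-+ (Λ-Γ₀ (transvection c i j) τ∈Γ₀ y∈Λ) (Λ-ℤ* -[1+ 0 ] y∈Λ)) λ l →
      trans (cancel (y l) _) (cong (ℚ._+ _) (sym (ιM-transvection c i j y l)))
    where
    cancel : ∀ a t → t ≡ a ℚ.+ t ℚ.+ ℚ.- 1ℚ ℚ.* a
    cancel = solve-∀ ℚ-ring

  τ₀₁∈Γ₀ : Γ₀ N (transvection (+ 1) i0 i1)
  τ₀₁∈Γ₀ = refl , N ∣0 , N ∣0

  τ₀₂∈Γ₀ : Γ₀ N (transvection (+ 1) i0 i2)
  τ₀₂∈Γ₀ = refl , N ∣0 , N ∣0

  τ₁₀∈Γ₀ : Γ₀ N (transvection (+ 1) i1 i0)
  τ₁₀∈Γ₀ = refl , N ∣0 , N ∣0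

  τ₂₀∈Γ₀ : Γ₀ N (transvection (+ N) i2 i0)
  τ₂₀∈Γ₀ = refl , ℕ∣.∣-refl , N ∣0

  elementary-Axis : ∀ i j → Γ₀ N (transvection (+ 1) i j) → ∀ {y} → Λ y → Axis i (y j)
  elementary-Axis i j τ∈Γ₀ {y} y∈Λ =
    subst (Axis i) (ℚP.*-identityˡ (y j)) (transvection-Axis (+ 1) i j τ∈Γ₀ y∈Λ)

  coordinate-Axis₀ : ∀ {y} → Λ y → ∀ k → Axis i0 (y k)
  coordinate-Axis₀ y∈Λ zero             = elementary-Axis i0 i1 τ₀₁∈Γ₀ (elementary-Axis i1 i0 τ₁₀∈Γ₀ y∈Λ)
  coordinate-Axis₀ y∈Λ (suc zero)       = elementary-Axis i0 i1 τ₀₁∈Γ₀ y∈Λ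
  coordinate-Axis₀ y∈Λ (suc (suc zero)) = elementary-Axis i0 i2 τ₀₂∈Γ₀ y∈Λ

  Axis₀⇒Axis₁ : ∀ {t} → Axis i0 t → Axis i1 t
  Axis₀⇒Axis₁ = elementary-Axis i1 i0 τ₁₀∈Γ₀

  Axis₂⇒Axis₀ : ∀ {t} → Axis i2 t → Axis i0 t
  Axis₂⇒Axis₀ t∈ = coordinate-Axis₀ t∈ i2

  Axis₀⇒Axis₂ : ∀ {t} → Axis i0 t → Axis i2 (ι (+ N) ℚ.* t)
  Axis₀⇒Axis₂ = transvection-Axis (+ N) i2 i0 τ₂₀∈Γ₀

  coordinate-Axis₂ : ∀ {y} → Λ y → Axis i2 (y i2)
  coordinate-Axis₂ {y} y∈Λ =
    Λ-resp (Λ-+ y∈Λ (Λ-ℤ* -[1+ 0 ] (Λ-+ y₀e₀∈Λ (Axis₀⇒Axis₁ (coordinate-Axis₀ y∈Λ i1)))))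
      λ { zero → first (y i0) ; (suc zero) → second (y i1) ; (suc (suc zero)) → third (y i2) }
    where
    first : ∀ a → 0ℚ ≡ a ℚ.+ ℚ.- 1ℚ ℚ.* (a ℚ.+ 0ℚ)
    first = solve-∀ ℚ-ring
    second : ∀ b → 0ℚ ≡ b ℚ.+ ℚ.- 1ℚ ℚ.* (0ℚ ℚ.+ b)
    second = solve-∀ ℚ-ring
    y₀e₀∈Λ : Axis i0 (y i0)
    y₀e₀∈Λ = coordinate-Axis₀ y∈Λ i0
    third : ∀ c → c ≡ c ℚ.+ ℚ.- 1ℚ ℚ.* (0ℚ ℚ.+ 0ℚ)
    third = solve-∀ ℚ-ring

  Λ-∣ℤ : ∀ {t x} k → (∀ j → t ∣ℤ g k j) → Λ x → t ∣ℤ x k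
  Λ-∣ℤ k t∣g (v , x≡) = let c , g·v≡ = ∣ℤ-· g k v t∣g in c , trans (x≡ k) g·v≡

  Λ⊆ScaledL : ∀ {a M x} → (∀ i j → a ∣ℤ g i j) → (∀ {y} → Λ y → ι (+ M) ℚ.* a ∣ℤ y i2) →
    Λ x → ScaledL a M x
  Λ⊆ScaledL {a} {M} a∣g Ma∣Λ₂ x∈Λ with Λ-∣ℤ i0 (a∣g i0) x∈Λ | Λ-∣ℤ i1 (a∣g i1) x∈Λ | Ma∣Λ₂ x∈Λ
  ... | k₀ , x₀≡ | k₁ , x₁≡ | k₂ , x₂≡ =
    scaledL (vec3 k₀ k₁ (k₂ ℤ.* + M)) (divides k₂ refl) λ
      { zero → trans x₀≡ (ℚP.*-comm (ι k₀) a)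
      ; (suc zero) → trans x₁≡ (ℚP.*-comm (ι k₁) a)
      ; (suc (suc zero)) →
          trans x₂≡ (trans (regroup (ι k₂) (ι (+ M)) a) (cong (a ℚ.*_) (sym (ι-* k₂ (+ M))))) }
    where
    regroup : ∀ k m a → k ℚ.* (m ℚ.* a) ≡ a ℚ.* (k ℚ.* m)
    regroup = solve-∀ ℚ-ring

  ScaledL⊆Λ : ∀ {a M x} → Axis i0 a → Axis i2 (ι (+ M) ℚ.* a) → ScaledL a M x → Λ x
  ScaledL⊆Λ {a} {M} a∈ Ma∈ (scaledL Z (divides w Z₂≡) x≡) =
    Λ-resp (Λ-+ (Λ-+ (Λ-ℤ* (Z i0) a∈) (Λ-ℤ* (Z i1) (Axis₀⇒Axis₁ a∈))) (Λ-ℤ* w Ma∈)) λ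
      { zero → trans (x≡ i0) (first a (ι (Z i0)) (ι (Z i1)) (ι w))
      ; (suc zero) → trans (x≡ i1) (second a (ι (Z i0)) (ι (Z i1)) (ι w))
      ; (suc (suc zero)) → trans (x≡ i2) (trans (cong (λ z → a ℚ.* ι z) Z₂≡)
          (trans (cong (a ℚ.*_) (ι-* w (+ M))) (third a (ι (Z i0)) (ι (Z i1)) (ι w) (ι (+ M))))) }
    where
    first : ∀ a z₀ z₁ w → a ℚ.* z₀ ≡ z₀ ℚ.* a ℚ.+ z₁ ℚ.* 0ℚ ℚ.+ w ℚ.* 0ℚ
    first = solve-∀ ℚ-ring
    second : ∀ a z₀ z₁ w → a ℚ.* z₁ ≡ z₀ ℚ.* 0ℚ ℚ.+ z₁ ℚ.* a ℚ.+ w ℚ.* 0ℚ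
    second = solve-∀ ℚ-ring
    third : ∀ a z₀ z₁ w m → a ℚ.* (w ℚ.* m) ≡ z₀ ℚ.* 0ℚ ℚ.+ z₁ ℚ.* 0ℚ ℚ.+ w ℚ.* (m ℚ.* a)
    third = solve-∀ ℚ-ring

  opaque
    entry-generator : GL3+ g → ∃[ a ] 0ℚ < a × Axis i0 a × (∀ i j → a ∣ℤ g i j)
    entry-generator g∈GL
      with matrix-generator (Axis-subgroup i0) g (λ i j → coordinate-Axis₀ (Λ-column j) i)
    ... | t , t∈ , t∣g with positive-generator (Axis-subgroup i0) t∈ (det>0⇒divisor≢0 g g∈GL t∣g)
    ... | a , a>0 , a∈ , t∣⇒a∣ = a , a>0 , a∈ , λ i j → t∣⇒a∣ (t∣g i j)

    lastRow-generator : ∃[ b ] Axis i2 b × (∀ j → b ∣ℤ g i2 j)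
    lastRow-generator = generator (Axis-subgroup i2) (g i2) (λ j → coordinate-Axis₂ (Λ-column j))

  Λ≐scale-L : GL3+ g → ∃[ M ] M ∣ N × ∃[ q ] 0ℚ < q × (Λ ≐ scale q (L_ M))
  Λ≐scale-L g∈GL =
    let a , a>0 , a∈ , a∣g = entry-generator g∈GL
        b , b∈ , b∣g₂ = lastRow-generator
    in from-generators a>0 a∈ a∣g b∈ b∣g₂
    where
    from-generators : ∀ {a b} → 0ℚ < a → Axis i0 a → (∀ i j → a ∣ℤ g i j) →
      Axis i2 b → (∀ j → b ∣ℤ g i2 j) → ∃[ M ] M ∣ N × ∃[ q ] 0ℚ < q × (Λ ≐ scale q (L_ M))
    from-generators {a} {b} a>0 a∈ a∣g b∈ b∣g₂ =
      ℤ.∣ m ∣ , M∣N , a , a>0 ,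
      (λ x x∈Λ → ScaledL⇒scale-L (Λ⊆ScaledL {M = ℤ.∣ m ∣} a∣g (λ y∈Λ → b∣⇒Ma∣ (Λ-∣ℤ i2 b∣g₂ y∈Λ)) x∈Λ)) ,
      (λ x x∈ → ScaledL⊆Λ a∈ Ma∈ (scale-L⇒ScaledL a (ℤ.∣ m ∣) x∈))
      where
      instance
        a-nonZero : ℚ.NonZero a
        a-nonZero = ℚ.>-nonZero a>0
      -- b e₀ ∈ Λ and N a e₂ ∈ Λ: b is a multiple of a, and N a a multiple of b.
      b∈ℤa : a ∣ℤ b
      b∈ℤa = Λ-∣ℤ i0 (a∣g i0) (Axis₂⇒Axis₀ b∈)
      Na∈ℤb : b ∣ℤ ι (+ N) ℚ.* a
      Na∈ℤb = Λ-∣ℤ i2 b∣g₂ (Axis₀⇒Axis₂ a∈)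
      m k : ℤ
      m = proj₁ b∈ℤa
      k = proj₁ Na∈ℤb
      N≡km : + N ≡ k ℤ.* m
      N≡km = ι-cancelʳ (+ N) (k ℤ.* m) a (begin
        ι (+ N) ℚ.* a             ≡⟨ proj₂ Na∈ℤb ⟩
        ι k ℚ.* b                 ≡⟨ cong (ι k ℚ.*_) (proj₂ b∈ℤa) ⟩
        ι k ℚ.* (ι m ℚ.* a)       ≡⟨ ι-*-assoc k m refl ⟨
        ι (k ℤ.* m) ℚ.* a         ∎)
        where open ≡-Reasoning
      M∣N : ℤ.∣ m ∣ ∣ N
      M∣N = ℕ∣.divides ℤ.∣ k ∣ (trans (cong ℤ.∣_∣ N≡km) (ℤP.∣i*j∣≡∣i∣*∣j∣ k m))
      Ma∈ : Axis i2 (ι (+ ℤ.∣ m ∣) ℚ.* a)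
      Ma∈ = proj₁ (abs-multiple (Axis-subgroup i2) m b∈ (proj₂ b∈ℤa))
      b∣⇒Ma∣ : ∀ {r} → b ∣ℤ r → ι (+ ℤ.∣ m ∣) ℚ.* a ∣ℤ r
      b∣⇒Ma∣ = proj₂ (abs-multiple (Axis-subgroup i2) m b∈ (proj₂ b∈ℤa))

lemma4p2 : (N : ℕ) → N ≥ 1 → (g : Mat3 ℚ) → GL3+ g →
    ((∀ γ → Γ₀ N γ → image (ιM γ) (latticeOf g) ≐ latticeOf g)
      ⇔ (∃ λ (M : ℕ) → M ∣ N × ∃ λ (q : ℚ) → 0ℚ < q × (latticeOf g ≐ scale q (L_ M))))
lemma4p2 N _ g g∈GL⁺ = mk⇔
  (λ stable → Stable.Λ≐scale-L N g stable g∈GL⁺)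
  (λ (M , M∣N , q , _ , Λ≐qL) → scale-L-stable q M∣N Λ≐qL)
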